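{- Let $a, b$ be nonnegative integers with $a \ge 1$. Let $G$ be a finite simple graph with $\mathrm{mad}(G) < \frac{4}{3}a + b$ that is not $(1_1, \ldots, 1_a, 0_1, \ldots, 0_b)$-colorable, and which has the fewest vertices among all such graphs. For a vertex $v$ let $h(v) = d(v) - (a+b)$. Let $v \in V(G)$ with $h(v) < a + b$, and consider any $(1_1, \ldots, 1_a, 0_1, \ldots, 0_b)$-coloring of $G - v$. Then $v$ has at least $a + b - h(v)$ saturated neighbors whose colors appear exactly once among the neighbors of $v$, and among these neighbors at least $\max\{a - h(v), 0\}$ are $1$-saturated.
   Context: A graph $G$ is $(1_1, \ldots, 1_a, 0_1, \ldots, 0_b)$-colorable if $V(G)$ can be partitioned into $b$ independent sets $O_1,\ldots,O_b$ (colors $0_1,\dots,0_b$) and $a$ sets $D_1,\ldots,D_a$ (colors $1_1,\dots,1_a$) such that each induced subgraph $G[D_i]$ has maximum degree at most $1$; such a partition is called a coloring. The maximum average degree $\mathrm{mad}(G)$ is the maximum, over all subgraphs $H$ of $G$, of $2|E(H)|/|V(H)|$. In a coloring of $G - v$, a vertex is $0$-saturated if it has some color $0_i$, and $1$-saturated if it has some color $1_j$ and has a neighbor also colored $1_j$; it is saturated if it is $0$-saturated or $1$-saturated. $d(v)$ denotes the degree of $v$ in $G$ and $N(v)$ its neighborhood in $G$. -}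

module Defs where

import Agda.Primitive
open import Data.Integer using (ℤ; +_; _-_)

open import Data.Nat using (ℕ; _+_; _*_; _<_; _<?_)
open import Data.Fin using (Fin; toℕ)
open import Data.Fin.Properties using (any?; all?) renaming (_≟_ to _≟ᶠ_)
open import Data.List using (List; length; filter; allFin; cartesianProduct)
open import Data.Product using (Σ; ∃; ∃-syntax; _×_; _,_; proj₁; proj₂)
open import Data.Sum using (_⊎_; inj₁; inj₂)
open import Data.Sum.Properties using (≡-dec)
open import Data.Unit using (⊤)
open import Data.Empty using (⊥)
open import Relation.Nullary using (¬_; Dec; yes; no)
open import Relation.Nullary.Decidable using (_×-dec_; _⊎-dec_; _→-dec_; ¬?)
open import Relation.Unary using (Pred; Decidable)
import Relation.Binary as B
open import Relation.Binary.PropositionalEquality using (_≡_; _≢_; refl)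

record Graph (n : ℕ) : Set₁ where
  field
    Adj    : Fin n → Fin n → Set
    adj?   : B.Decidable Adj
    sym    : ∀ {u w} → Adj u w → Adj w u
    irrefl : ∀ {u} → ¬ Adj u u
open Graph public

count : ∀ {n} {P : Pred (Fin n) Agda.Primitive.lzero} → Decidable P → ℕ
count {n} P? = length (filter P? (allFin n))

deg : ∀ {n} (G : Graph n) → Fin n → ℕ
deg G v = count (adj? G v)

h : ∀ {n} (G : Graph n) → ℕ → ℕ → Fin n → ℤ
h G a b v = + deg G v - + (a + b)

record Subgraph {n : ℕ} (G : Graph n) : Set₁ where
  field
    InV   : Fin n → Set
    inV?  : Decidable InV
    InE   : Fin n → Fin n → Set
    inE?  : B.Decidable InE
    E-sym : ∀ {u w} → InE u w → InE w u
    E-adj : ∀ {u w} → InE u w → Adj G u w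
    E-ends : ∀ {u w} → InE u w → InV u × InV w
open Subgraph public

nV : ∀ {n} {G : Graph n} → Subgraph G → ℕ
nV H = count (inV? H)

-- |E(H)| : each edge {u,w} counted once, as the pair with toℕ u < toℕ w
nE : ∀ {n} {G : Graph n} → Subgraph G → ℕ
nE {n} H = length (filter (λ p → (toℕ (proj₁ p) <? toℕ (proj₂ p)) ×-dec inE? H (proj₁ p) (proj₂ p))
                          (cartesianProduct (allFin n) (allFin n)))

-- mad(G) < 4a/3 + b, i.e. every (nonempty) subgraph H has
-- 2|E(H)|/|V(H)| < 4a/3 + b, i.e. 3·(2|E(H)|) < (4a + 3b)·|V(H)|.
MadLess : ∀ {n} → Graph n → ℕ → ℕ → Set₁
MadLess G a b = ∀ (H : Subgraph G) → 0 < nV H → 3 * (2 * nE H) < (4 * a + 3 * b) * nV H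

-- (1_1,…,1_a,0_1,…,0_b)-colorings.  inj₁ j = colour 1_j, inj₂ i = colour 0_i.

Color : ℕ → ℕ → Set
Color a b = Fin a ⊎ Fin b

-- c is a valid colouring of the subgraph of G induced by the vertices in P:
-- each class 0_i is independent, each class 1_j induces max degree ≤ 1.
ValidOn : ∀ {n a b} (G : Graph n) → (Fin n → Set) → (Fin n → Color a b) → Set
ValidOn {n} {a} {b} G P c =
  (∀ u w → P u → P w → Adj G u w → ∀ (i : Fin b) → c u ≡ inj₂ i → c w ≡ inj₂ i → ⊥)
  × (∀ u w₁ w₂ → P u → P w₁ → P w₂ → Adj G u w₁ → Adj G u w₂ →
       ∀ (j : Fin a) → c u ≡ inj₁ j → c w₁ ≡ inj₁ j → c w₂ ≡ inj₁ j → w₁ ≡ w₂)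

Colorable : ℕ → ℕ → ∀ {n} → Graph n → Set
Colorable a b G = ∃[ c ] ValidOn {a = a} {b = b} G (λ _ → ⊤) c

ColoringMinus : ∀ {n a b} (G : Graph n) → Fin n → (Fin n → Color a b) → Set
ColoringMinus G v c = ValidOn G (λ u → u ≢ v) c

ZeroSat : ∀ {n a b} → (Fin n → Color a b) → Fin n → Set
ZeroSat {b = b} c u = ∃[ i ] c u ≡ inj₂ {B = Fin b} i

OneSat : ∀ {n a b} (G : Graph n) → Fin n → (Fin n → Color a b) → Fin n → Set
OneSat {a = a} G v c u = ∃[ j ] (c u ≡ inj₁ j × ∃[ w ] (w ≢ v × Adj G u w × c w ≡ inj₁ j))

Saturated : ∀ {n a b} (G : Graph n) → Fin n → (Fin n → Color a b) → Fin n → Set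
Saturated G v c u = ZeroSat c u ⊎ OneSat G v c u

-- the colour of u appears exactly once among the neighbours of v
-- (u is itself assumed to be a neighbour of v)
UniqueColor : ∀ {n a b} (G : Graph n) → Fin n → (Fin n → Color a b) → Fin n → Set
UniqueColor G v c u = ∀ u' → Adj G v u' → c u' ≡ c u → u' ≡ u

GoodNbr : ∀ {n a b} (G : Graph n) → Fin n → (Fin n → Color a b) → Fin n → Set
GoodNbr G v c u = Adj G v u × Saturated G v c u × UniqueColor G v c u

GoodNbr1 : ∀ {n a b} (G : Graph n) → Fin n → (Fin n → Color a b) → Fin n → Set
GoodNbr1 G v c u = GoodNbr G v c u × OneSat G v c u

colorEq? : ∀ {a b} → B.DecidableEquality (Color a b)
colorEq? = ≡-dec _≟ᶠ_ _≟ᶠ_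

zeroSat? : ∀ {n a b} (c : Fin n → Color a b) → Decidable (ZeroSat c)
zeroSat? c u with c u
... | inj₁ j = no λ { (i , ()) }
... | inj₂ i = yes (i , refl)

oneSat? : ∀ {n a b} (G : Graph n) v (c : Fin n → Color a b) → Decidable (OneSat G v c)
oneSat? G v c u with c u
... | inj₂ i = no λ { (j , () , _) }
... | inj₁ j with any? (λ w → ¬? (w ≟ᶠ v) ×-dec adj? G u w ×-dec colorEq? (c w) (inj₁ j))
...   | yes (w , p , q , r) = yes (j , refl , w , p , q , r)
...   | no ¬e = no λ { (j' , refl , w , p , q , r) → ¬e (w , p , q , r) }

saturated? : ∀ {n a b} (G : Graph n) v (c : Fin n → Color a b) → Decidable (Saturated G v c)
saturated? G v c u = zeroSat? c u ⊎-dec oneSat? G v c u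

uniqueColor? : ∀ {n a b} (G : Graph n) v (c : Fin n → Color a b) → Decidable (UniqueColor G v c)
uniqueColor? G v c u = all? (λ u' → adj? G v u' →-dec (colorEq? (c u') (c u) →-dec (u' ≟ᶠ u)))

goodNbr? : ∀ {n a b} (G : Graph n) v (c : Fin n → Color a b) → Decidable (GoodNbr G v c)
goodNbr? G v c u = adj? G v u ×-dec saturated? G v c u ×-dec uniqueColor? G v c u

goodNbr1? : ∀ {n a b} (G : Graph n) v (c : Fin n → Color a b) → Decidable (GoodNbr1 G v c)
goodNbr1? G v c u = goodNbr? G v c u ×-dec oneSat? G v c u

-- Recolouring v with a colour k extends the colouring of G - v unless k is
-- blocked, and G is not colourable, so every colour is blocked: 0_i because
-- some neighbour of v has colour 0_i, and 1_j because either two neighbours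
-- of v have colour 1_j or the only one is 1-saturated.  Hence each colour
-- occurs on two neighbours of v or on a single good one, and each 1-colour
-- on two neighbours or on a single good 1-saturated one.  Summing over the
-- colours (each 0-colour occurring at least once) gives
-- d(v) + #good ≥ 2(a + b) and d(v) + #good₁ ≥ 2a + b.
module Submission where

open import Defs
open import Data.Nat using (ℕ; _≤_; _<_)
open import Data.Fin using (Fin)
open import Data.Integer using (ℤ; +_; _-_; _⊔_) renaming (_<_ to _<ℤ_; _≤_ to _≤ℤ_)
open import Data.Product using (_×_)
open import Relation.Nullary using (¬_)

open import Agda.Primitive using (lzero)
open import Data.Bool using (true; false; if_then_else_)
open import Data.Bool.Properties using (∧-identityʳ; ∧-zeroʳ)
open import Data.Empty using (⊥; ⊥-elim)
open import Data.Fin using (zero; suc; punchIn)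
open import Data.Fin.Properties using (any?; punchInᵢ≢i) renaming (_≟_ to _≟ᶠ_)
import Data.Integer as ℤ
import Data.Integer.Properties as ℤ
import Data.Integer.Tactic.RingSolver as ℤ-Solver
open import Data.List using ([]; _∷_; length; filter; allFin)
open import Data.List.Membership.Propositional using (_∈_)
open import Data.List.Membership.Propositional.Properties using (∈-allFin; ∈-filter⁺; ∈-length)
open import Data.List.Relation.Unary.Any using (here; there)
open import Data.Nat using (_+_; _*_; z≤n; s≤s)
open import Data.Nat.Properties
  using (+-0-commutativeMonoid; +-identityʳ; ≤-trans; m≤m+n; m≤n⇒m≤1+n; +-mono-≤; module ≤-Reasoning)
open import Data.Nat.Tactic.RingSolver using (solve-∀)
open import Data.Product using (∃; _,_; proj₁; proj₂)
open import Data.Sum using (_⊎_; inj₁; inj₂)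
open import Data.Unit using (⊤)
open import Data.Vec.Functional using (Vector)
open import Relation.Nullary using (Dec; yes; no; does)
open import Relation.Nullary.Decidable using (_×-dec_; ¬?; dec-true; dec-false)
open import Relation.Unary using (Pred; Decidable)
open import Relation.Binary.PropositionalEquality
  using (_≡_; _≢_; refl; trans; cong; cong₂; subst; module ≡-Reasoning)
  renaming (sym to ≡-sym)

open import Algebra.Properties.CommutativeMonoid.Sum +-0-commutativeMonoid
  using (sum; sum-cong-≗; sum-remove; sum-replicate-zero; ∑-distrib-+)

sum-zero : ∀ {k} (f : Vector ℕ k) → (∀ i → f i ≡ 0) → sum f ≡ 0
sum-zero {k} f f≡0 = trans (sum-cong-≗ f≡0) (sum-replicate-zero k)

sum-single : ∀ {k} (f : Vector ℕ k) (j : Fin k) → (∀ i → i ≢ j → f i ≡ 0) → sum f ≡ f j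
sum-single {ℕ.suc _} f j off-j = begin
  sum f                             ≡⟨ sum-remove f ⟩
  f j + sum (λ i → f (punchIn j i)) ≡⟨ cong (_+_ (f j)) (sum-zero _ (λ i → off-j _ (punchInᵢ≢i j i))) ⟩
  f j + 0                           ≡⟨ +-identityʳ (f j) ⟩
  f j                               ∎
  where open ≡-Reasoning

*-≤-sum : ∀ {k} x (f : Vector ℕ k) → (∀ i → x ≤ f i) → k * x ≤ sum f
*-≤-sum {ℕ.zero} x f x≤f = z≤n
*-≤-sum {ℕ.suc k} x f x≤f = +-mono-≤ (x≤f zero) (*-≤-sum x (λ i → f (suc i)) (λ i → x≤f (suc i)))

module _ {a b : ℕ} where

  sumColor : (Color a b → ℕ) → ℕ
  sumColor f = sum (λ j → f (inj₁ j)) + sum (λ i → f (inj₂ i))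

  sumColor-cong : {f g : Color a b → ℕ} → (∀ k → f k ≡ g k) → sumColor f ≡ sumColor g
  sumColor-cong f≡g = cong₂ _+_ (sum-cong-≗ (λ j → f≡g (inj₁ j))) (sum-cong-≗ (λ i → f≡g (inj₂ i)))

  sumColor-zero : sumColor (λ _ → 0) ≡ 0
  sumColor-zero = cong₂ _+_ (sum-zero {a} _ (λ _ → refl)) (sum-zero {b} _ (λ _ → refl))

  sumColor-+ : (f g : Color a b → ℕ) → sumColor (λ k → f k + g k) ≡ sumColor f + sumColor g
  sumColor-+ f g = trans
    (cong₂ _+_ (∑-distrib-+ (λ j → f (inj₁ j)) (λ j → g (inj₁ j)))
               (∑-distrib-+ (λ i → f (inj₂ i)) (λ i → g (inj₂ i))))
    (interchange (sum (λ j → f (inj₁ j))) (sum (λ j → g (inj₁ j)))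
                 (sum (λ i → f (inj₂ i))) (sum (λ i → g (inj₂ i))))
    where
    interchange : ∀ p q r s → (p + q) + (r + s) ≡ (p + r) + (q + s)
    interchange = solve-∀

  sumColor-single : (f : Color a b → ℕ) (y : Color a b) → (∀ k → k ≢ y → f k ≡ 0) → sumColor f ≡ f y
  sumColor-single f (inj₁ j) off-y = trans
    (cong₂ _+_ (sum-single (λ j′ → f (inj₁ j′)) j (λ j′ j′≢j → off-y _ (λ { refl → j′≢j refl })))
               (sum-zero (λ i → f (inj₂ i)) (λ i → off-y _ (λ ()))))
    (+-identityʳ (f (inj₁ j)))
  sumColor-single f (inj₂ i) off-y =
    cong₂ _+_ (sum-zero (λ j → f (inj₁ j)) (λ j → off-y _ (λ ())))
              (sum-single (λ i′ → f (inj₂ i′)) i (λ i′ i′≢i → off-y _ (λ { refl → i′≢i refl })))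

  sumColor-≥ : ∀ x y (f : Color a b → ℕ) → (∀ j → x ≤ f (inj₁ j)) → (∀ i → y ≤ f (inj₂ i)) →
               a * x + b * y ≤ sumColor f
  sumColor-≥ x y f x≤f y≤f = +-mono-≤ (*-≤-sum x _ x≤f) (*-≤-sum y _ y≤f)

indicator : ∀ {P : Set} → Dec P → ℕ
indicator P? = if does P? then 1 else 0

indicator-×-yes : ∀ {P Q : Set} (P? : Dec P) (Q? : Dec Q) → Q → indicator (P? ×-dec Q?) ≡ indicator P?
indicator-×-yes P? Q? q rewrite dec-true Q? q | ∧-identityʳ (does P?) = refl

indicator-×-no : ∀ {P Q : Set} (P? : Dec P) (Q? : Dec Q) → ¬ Q → indicator (P? ×-dec Q?) ≡ 0
indicator-×-no P? Q? ¬q rewrite dec-false Q? ¬q | ∧-zeroʳ (does P?) = refl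

length-filter-∷ : ∀ {A : Set} {P : Pred A lzero} (P? : Decidable P) x xs →
                  length (filter P? (x ∷ xs)) ≡ indicator (P? x) + length (filter P? xs)
length-filter-∷ P? x xs with does (P? x)
... | true  = refl
... | false = refl

module _ {a b : ℕ} {A : Set} {P : Pred A lzero} (P? : Decidable P) (c : A → Color a b) where

  colored? : (k : Color a b) → Decidable (λ u → P u × c u ≡ k)
  colored? k u = P? u ×-dec colorEq? (c u) k

  indicator-byColor : ∀ x → indicator (P? x) ≡ sumColor (λ k → indicator (colored? k x))
  indicator-byColor x = ≡-sym (trans
    (sumColor-single (λ k → indicator (colored? k x)) (c x)
      (λ k k≢cx → indicator-×-no (P? x) (colorEq? (c x) k) (λ cx≡k → k≢cx (≡-sym cx≡k))))
    (indicator-×-yes (P? x) (colorEq? (c x) (c x)) refl))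

  length-filter-byColor : ∀ xs → length (filter P? xs) ≡ sumColor (λ k → length (filter (colored? k) xs))
  length-filter-byColor [] = ≡-sym (sumColor-zero {a} {b})
  length-filter-byColor (x ∷ xs) = begin
    length (filter P? (x ∷ xs))
      ≡⟨ length-filter-∷ P? x xs ⟩
    indicator (P? x) + length (filter P? xs)
      ≡⟨ cong₂ _+_ (indicator-byColor x) (length-filter-byColor xs) ⟩
    sumColor (λ k → indicator (colored? k x)) + sumColor (λ k → length (filter (colored? k) xs))
      ≡⟨ ≡-sym (sumColor-+ (λ k → indicator (colored? k x)) (λ k → length (filter (colored? k) xs))) ⟩
    sumColor (λ k → indicator (colored? k x) + length (filter (colored? k) xs))
      ≡⟨ sumColor-cong (λ k → ≡-sym (length-filter-∷ (colored? k) x xs)) ⟩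
    sumColor (λ k → length (filter (colored? k) (x ∷ xs)))
      ∎
    where open ≡-Reasoning

count-+-count-≥ : ∀ {n a b} {P Q : Pred (Fin n) lzero} (P? : Decidable P) (Q? : Decidable Q)
                  (c : Fin n → Color a b) x y →
                  (∀ j → x ≤ count (colored? P? c (inj₁ j)) + count (colored? Q? c (inj₁ j))) →
                  (∀ i → y ≤ count (colored? P? c (inj₂ i)) + count (colored? Q? c (inj₂ i))) →
                  a * x + b * y ≤ count P? + count Q?
count-+-count-≥ {n} {a} {b} P? Q? c x y x≤ y≤ = begin
  a * x + b * y
    ≤⟨ sumColor-≥ x y (λ k → count (colored? P? c k) + count (colored? Q? c k)) x≤ y≤ ⟩
  sumColor (λ k → count (colored? P? c k) + count (colored? Q? c k))
    ≡⟨ sumColor-+ (λ k → count (colored? P? c k)) (λ k → count (colored? Q? c k)) ⟩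
  sumColor (λ k → count (colored? P? c k)) + sumColor (λ k → count (colored? Q? c k))
    ≡⟨ ≡-sym (cong₂ _+_ (length-filter-byColor P? c (allFin n)) (length-filter-byColor Q? c (allFin n))) ⟩
  count P? + count Q?
    ∎
  where open ≤-Reasoning

count-≥1 : ∀ {n} {P : Pred (Fin n) lzero} (P? : Decidable P) {u} → P u → 1 ≤ count P?
count-≥1 P? {u} pu = ∈-length (∈-filter⁺ P? (∈-allFin u) pu)

distinct-∈⇒2≤length : ∀ {A : Set} {x y : A} {xs} → x ∈ xs → y ∈ xs → x ≢ y → 2 ≤ length xs
distinct-∈⇒2≤length (here refl) (here refl) x≢y = ⊥-elim (x≢y refl)
distinct-∈⇒2≤length (here refl) (there y∈) _   = s≤s (∈-length y∈)
distinct-∈⇒2≤length (there x∈) (here refl) _   = s≤s (∈-length x∈)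
distinct-∈⇒2≤length (there x∈) (there y∈) x≢y = m≤n⇒m≤1+n (distinct-∈⇒2≤length x∈ y∈ x≢y)

count-≥2 : ∀ {n} {P : Pred (Fin n) lzero} (P? : Decidable P) {u w} → P u → P w → u ≢ w → 2 ≤ count P?
count-≥2 P? {u} {w} pu pw =
  distinct-∈⇒2≤length (∈-filter⁺ P? (∈-allFin u) pu) (∈-filter⁺ P? (∈-allFin w) pw)

-- The two components of ValidOn G (λ _ → ⊤) c.
ZeroClassesIndependent : ∀ {n a b} (G : Graph n) → (Fin n → Color a b) → Set
ZeroClassesIndependent {n} {a} {b} G c =
  ∀ u w → ⊤ → ⊤ → Adj G u w → ∀ (i : Fin b) → c u ≡ inj₂ i → c w ≡ inj₂ i → ⊥

OneClassesMatchings : ∀ {n a b} (G : Graph n) → (Fin n → Color a b) → Set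
OneClassesMatchings {n} {a} {b} G c =
  ∀ u w₁ w₂ → ⊤ → ⊤ → ⊤ → Adj G u w₁ → Adj G u w₂ →
  ∀ (j : Fin a) → c u ≡ inj₁ j → c w₁ ≡ inj₁ j → c w₂ ≡ inj₁ j → w₁ ≡ w₂

neighbour-≢ : ∀ {n} (G : Graph n) {u w} → Adj G u w → w ≢ u
neighbour-≢ G uw refl = irrefl G uw

module Extension {n a b} (G : Graph n) (v : Fin n) (c : Fin n → Color a b) (c-valid : ColoringMinus G v c) where

  extend : Color a b → Fin n → Color a b
  extend k u = if does (u ≟ᶠ v) then k else c u

  extend-at : ∀ {k x} → extend k v ≡ x → k ≡ x
  extend-at {k} e rewrite dec-true (v ≟ᶠ v) refl = e

  extend-off : ∀ {k u x} → u ≢ v → extend k u ≡ x → c u ≡ x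
  extend-off {u = u} u≢v e rewrite dec-false (u ≟ᶠ v) u≢v = e

  extend-avoids : ∀ {k u x} → extend k u ≡ x → x ≢ k → u ≢ v
  extend-avoids e x≢k refl = x≢k (≡-sym (extend-at e))

  zeros-unchanged : ∀ {j} → ZeroClassesIndependent G (extend (inj₁ j))
  zeros-unchanged u w _ _ uw i eu ew =
    proj₁ c-valid u w u≢v w≢v uw i (extend-off u≢v eu) (extend-off w≢v ew)
    where
    u≢v = extend-avoids eu (λ ())
    w≢v = extend-avoids ew (λ ())

  ones-unchanged : ∀ {i} → OneClassesMatchings G (extend (inj₂ i))
  ones-unchanged u w₁ w₂ _ _ _ uw₁ uw₂ j eu e₁ e₂ =
    proj₂ c-valid u w₁ w₂ u≢v w₁≢v w₂≢v uw₁ uw₂ j (extend-off u≢v eu) (extend-off w₁≢v e₁) (extend-off w₂≢v e₂)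
    where
    u≢v = extend-avoids eu (λ ())
    w₁≢v = extend-avoids e₁ (λ ())
    w₂≢v = extend-avoids e₂ (λ ())

  zeros-at-v : ∀ {i} → (∀ w → Adj G v w → c w ≢ inj₂ i) → ZeroClassesIndependent G (extend (inj₂ i))
  zeros-at-v free u w _ _ uw i′ eu ew with u ≟ᶠ v | w ≟ᶠ v
  ... | yes refl | yes refl = irrefl G uw
  ... | yes refl | no w≢v   = free w uw (trans ew (≡-sym eu))
  ... | no u≢v   | yes refl = free u (sym G uw) (trans eu (≡-sym ew))
  ... | no u≢v   | no w≢v   = proj₁ c-valid u w u≢v w≢v uw i′ eu ew

  module _ {j : Fin a}
           (lone : ∀ w₁ w₂ → Adj G v w₁ → Adj G v w₂ → c w₁ ≡ inj₁ j → c w₂ ≡ inj₁ j → w₁ ≡ w₂)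
           (unsaturated : ∀ w → Adj G v w → c w ≡ inj₁ j → ¬ OneSat G v c w) where

    ones-centred-off-v : ∀ {u w₁ w₂ j′} → u ≢ v → Adj G u w₁ → Adj G u w₂ → c u ≡ inj₁ j′ →
                         extend (inj₁ j) w₁ ≡ inj₁ j′ → extend (inj₁ j) w₂ ≡ inj₁ j′ → w₁ ≡ w₂
    ones-centred-off-v {u} {w₁} {w₂} {j′} u≢v uw₁ uw₂ cu e₁ e₂ with w₁ ≟ᶠ v | w₂ ≟ᶠ v
    ... | yes refl | yes refl = refl
    ... | yes refl | no w₂≢v  =
      ⊥-elim (unsaturated u (sym G uw₁) (trans cu (≡-sym e₁)) (j′ , cu , w₂ , w₂≢v , uw₂ , e₂))
    ... | no w₁≢v  | yes refl =
      ⊥-elim (unsaturated u (sym G uw₂) (trans cu (≡-sym e₂)) (j′ , cu , w₁ , w₁≢v , uw₁ , e₁))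
    ... | no w₁≢v  | no w₂≢v  =
      proj₂ c-valid u w₁ w₂ u≢v w₁≢v w₂≢v uw₁ uw₂ j′ cu e₁ e₂

    ones-at-v : OneClassesMatchings G (extend (inj₁ j))
    ones-at-v u w₁ w₂ _ _ _ uw₁ uw₂ j′ eu e₁ e₂ with u ≟ᶠ v
    ... | yes refl = lone w₁ w₂ uw₁ uw₂
      (trans (extend-off (neighbour-≢ G uw₁) e₁) (≡-sym eu))
      (trans (extend-off (neighbour-≢ G uw₂) e₂) (≡-sym eu))
    ... | no u≢v = ones-centred-off-v u≢v uw₁ uw₂ eu e₁ e₂

    extend-one : Colorable a b G
    extend-one = extend (inj₁ j) , zeros-unchanged , ones-at-v

  extend-zero : ∀ {i} → (∀ w → Adj G v w → c w ≢ inj₂ i) → Colorable a b G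
  extend-zero free = extend (inj₂ _) , zeros-at-v free , ones-unchanged

module Blocked {n a b} (G : Graph n) (v : Fin n) (c : Fin n → Color a b)
               (c-valid : ColoringMinus G v c) (¬colorable : ¬ Colorable a b G) where

  open Extension G v c c-valid

  color-present : ∀ k → ∃ λ u → Adj G v u × c u ≡ k
  color-present k with any? (colored? (adj? G v) c k)
  ... | yes found = found
  ... | no none with k
  ...   | inj₂ i = ⊥-elim (¬colorable (extend-zero (λ w vw cw → none (w , vw , cw))))
  ...   | inj₁ j = ⊥-elim (¬colorable (extend-one (λ w₁ _ vw₁ _ cw₁ _ → ⊥-elim (none (w₁ , vw₁ , cw₁)))
                                                  (λ w vw cw _ → none (w , vw , cw))))

  lone-saturated : ∀ {k u} → c u ≡ k → (∀ w → Adj G v w → c w ≡ k → w ≡ u) → Saturated G v c u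
  lone-saturated {inj₂ i} cu _ = inj₁ (i , cu)
  lone-saturated {inj₁ j} {u} cu lone with oneSat? G v c u
  ... | yes sat = inj₂ sat
  ... | no ¬sat = ⊥-elim (¬colorable (extend-one
    (λ w₁ w₂ vw₁ vw₂ cw₁ cw₂ → trans (lone w₁ vw₁ cw₁) (≡-sym (lone w₂ vw₂ cw₂)))
    (λ w vw cw sat → ¬sat (subst (OneSat G v c) (lone w vw cw) sat))))

  crowded-or-good : ∀ k → 2 ≤ count (colored? (adj? G v) c k) ⊎ ∃ λ u → GoodNbr G v c u × c u ≡ k
  crowded-or-good k with color-present k
  ... | u , vu , cu with any? (λ w → colored? (adj? G v) c k w ×-dec ¬? (w ≟ᶠ u))
  ...   | yes (w , (vw , cw) , w≢u) = inj₁ (count-≥2 (colored? (adj? G v) c k) (vw , cw) (vu , cu) w≢u)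
  ...   | no none = inj₂ (u , (vu , lone-saturated cu lone , λ w vw cw → lone w vw (trans cw cu)) , cu)
    where
    lone : ∀ w → Adj G v w → c w ≡ k → w ≡ u
    lone w vw cw with w ≟ᶠ u
    ... | yes w≡u = w≡u
    ... | no w≢u  = ⊥-elim (none (w , (vw , cw) , w≢u))

  one-saturated : ∀ {u j} → c u ≡ inj₁ j → Saturated G v c u → OneSat G v c u
  one-saturated cu (inj₁ (i , cu′)) with trans (≡-sym cu) cu′
  ... | ()
  one-saturated cu (inj₂ sat) = sat

  good-bound : ∀ k → 2 ≤ count (colored? (adj? G v) c k) + count (colored? (goodNbr? G v c) c k)
  good-bound k with crowded-or-good k
  ... | inj₁ crowded         = ≤-trans crowded (m≤m+n _ _)
  ... | inj₂ (u , good , cu) =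
    +-mono-≤ (count-≥1 (colored? (adj? G v) c k) (proj₁ good , cu))
             (count-≥1 (colored? (goodNbr? G v c) c k) (good , cu))

  good₁-bound : ∀ j → 2 ≤ count (colored? (adj? G v) c (inj₁ j)) + count (colored? (goodNbr1? G v c) c (inj₁ j))
  good₁-bound j with crowded-or-good (inj₁ j)
  ... | inj₁ crowded                        = ≤-trans crowded (m≤m+n _ _)
  ... | inj₂ (u , good@(vu , sat , _) , cu) =
    +-mono-≤ (count-≥1 (colored? (adj? G v) c (inj₁ j)) (vu , cu))
             (count-≥1 (colored? (goodNbr1? G v c) c (inj₁ j)) ((good , one-saturated cu sat) , cu))

  present-bound : ∀ {Q : Pred (Fin n) lzero} (Q? : Decidable Q) k →
                  1 ≤ count (colored? (adj? G v) c k) + count (colored? Q? c k)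
  present-bound Q? k with color-present k
  ... | u , vu , cu = ≤-trans (count-≥1 (colored? (adj? G v) c k) (vu , cu)) (m≤m+n _ _)

  degree-+-good : (a + b) + (a + b) ≤ deg G v + count (goodNbr? G v c)
  degree-+-good = subst (_≤ deg G v + count (goodNbr? G v c)) (twice a b)
    (count-+-count-≥ (adj? G v) (goodNbr? G v c) c 2 2 (λ j → good-bound (inj₁ j)) (λ i → good-bound (inj₂ i)))
    where
    twice : ∀ a b → a * 2 + b * 2 ≡ (a + b) + (a + b)
    twice = solve-∀

  degree-+-good₁ : a + (a + b) ≤ deg G v + count (goodNbr1? G v c)
  degree-+-good₁ = subst (_≤ deg G v + count (goodNbr1? G v c)) (twice-a-+-b a b)
    (count-+-count-≥ (adj? G v) (goodNbr1? G v c) c 2 1 good₁-bound (λ i → present-bound (goodNbr1? G v c) (inj₂ i)))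
    where
    twice-a-+-b : ∀ a b → a * 2 + b * 1 ≡ a + (a + b)
    twice-a-+-b = solve-∀

+m-[+n-+o]≤+p : ∀ m n o p → m + o ≤ n + p → + m - (+ n - + o) ≤ℤ + p
+m-[+n-+o]≤+p m n o p m+o≤n+p = begin
  + m - (+ n - + o)      ≡⟨ shuffle (+ m) (+ o) (+ n) ⟩
  + m ℤ.+ + o ℤ.- + n    ≡⟨ cong (ℤ._- + n) (≡-sym (ℤ.pos-+ m o)) ⟩
  + (m + o) ℤ.- + n      ≤⟨ ℤ.+-monoˡ-≤ (ℤ.- + n) (ℤ.+≤+ m+o≤n+p) ⟩
  + (n + p) ℤ.- + n      ≡⟨ cong (ℤ._- + n) (ℤ.pos-+ n p) ⟩
  + n ℤ.+ + p ℤ.- + n    ≡⟨ cancel (+ n) (+ p) ⟩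
  + p                    ∎
  where
  open ℤ.≤-Reasoning
  shuffle : ∀ (x y z : ℤ) → x - (z - y) ≡ x ℤ.+ y ℤ.- z
  shuffle = ℤ-Solver.solve-∀
  cancel : ∀ (x y : ℤ) → x ℤ.+ y ℤ.- x ≡ y
  cancel = ℤ-Solver.solve-∀

lemma3 : (a b : ℕ) → 1 ≤ a →
         ∀ (n : ℕ) (G : Graph n) →
         MadLess G a b →
         ¬ Colorable a b G →
         (∀ (m : ℕ) (G' : Graph m) → m < n → MadLess G' a b → Colorable a b G') →
         ∀ (v : Fin n) →
         h G a b v <ℤ + (a Data.Nat.+ b) →
         ∀ (c : Fin n → Color a b) → ColoringMinus G v c →
         (+ (a Data.Nat.+ b) - h G a b v ≤ℤ + count (goodNbr? G v c))
         × ((+ a - h G a b v) ⊔ + 0 ≤ℤ + count (goodNbr1? G v c))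
lemma3 a b _ n G _ ¬colorable _ v _ c c-valid =
  +m-[+n-+o]≤+p (a + b) (deg G v) (a + b) _ degree-+-good ,
  ℤ.⊔-lub (+m-[+n-+o]≤+p a (deg G v) (a + b) _ degree-+-good₁) (ℤ.+≤+ z≤n)
  where open Blocked G v c c-valid ¬colorable
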